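{- Let $(R,\mathfrak{m})$ be a finite commutative local ring with identity, with $m=|\mathfrak{m}|$ and residue field $R/\mathfrak{m}\simeq\mathbb{F}_q$. Let $k\in\mathbb{N}$ be such that $(k,q-1)\mid \frac{q-1}{2}$. If $(k,q)=1$, then $$\mathcal{K}_{\ell}(G_R(k))=\mathcal{K}_{\ell}(\Gamma(k,q))\cdot m^{\ell}\quad\text{for all }\ell\in\mathbb{N}.$$
   Context: For a finite commutative ring $R$ with identity and $k\in\mathbb{N}$, let $U_R(k)=\{x^k : x\in R^*\}$ (where $R^*$ is the unit group) and let $G_R(k)=\mathrm{Cay}(R,U_R(k))$ be the Cayley graph with vertex set $R$, where $v,w$ are joined when $w-v\in U_R(k)$ (under the stated hypotheses $U_R(k)=-U_R(k)$, so the graph is undirected). The generalized Paley graph is $\Gamma(k,q)=G_{\mathbb{F}_q}(k)=\mathrm{Cay}(\mathbb{F}_q,\{x^k: x\in\mathbb{F}_q^*\})$. For a graph $H$, $\mathcal{K}_{\ell}(H)$ denotes the number of cliques (complete subgraphs) of $H$ with exactly $\ell$ vertices. $(a,b)$ denotes the greatest common divisor. -}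

module Defs where

open import Level using (Level; _⊔_) renaming (suc to lsuc)
open import Data.Nat using (ℕ; zero; suc)
open import Data.Fin using (Fin; zero; suc)
open import Data.Fin.Properties using (any?; all?)
open import Data.Fin.Subset using (Subset; _∈_; ∣_∣; inside; outside)
open import Data.Fin.Subset.Properties using (_∈?_)
open import Data.List using (List; allFin; []; _∷_; _++_; map; filter; length)
open import Data.Vec using (_∷_; [])
open import Data.Product using (Σ; ∃; _×_; _,_)
open import Relation.Nullary using (¬_; Dec)
open import Relation.Nullary.Decidable using (_×-dec_; _→-dec_; ¬?)
open import Relation.Binary using (Rel; Decidable)
open import Relation.Binary.PropositionalEquality using (_≡_; _≢_)
open import Algebra.Bundles using (CommutativeRing; Semiring)
open import Algebra.Morphism.Structures using (IsRingHomomorphism)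
import Algebra.Definitions.RawSemiring as RawSemiringDefs
import Data.Fin.Properties as FinP

record FiniteCommRing (c ℓ : Level) : Set (lsuc (c ⊔ ℓ)) where
  field
    commRing : CommutativeRing c ℓ
  open CommutativeRing commRing public
  open RawSemiringDefs (Semiring.rawSemiring (CommutativeRing.semiring commRing)) public using (_^_)
  field
    size      : ℕ
    enum      : Fin size → Carrier
    enum-surj : ∀ x → ∃ λ i → enum i ≈ x
    enum-inj  : ∀ i j → enum i ≈ enum j → i ≡ j
    _≈?_      : Decidable _≈_

module _ {c ℓ : Level} (R : FiniteCommRing c ℓ) where
  open FiniteCommRing R

  IsUnit : Carrier → Set (c ⊔ ℓ)
  IsUnit x = ∃ λ y → x * y ≈ 1#

  -- local ring: 1 ≠ 0 and the non-units form an ideal (closed under +;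
  -- closure under multiplication by ring elements is automatic)
  IsLocal : Set (c ⊔ ℓ)
  IsLocal = (¬ (1# ≈ 0#)) ×
            (∀ x y → ¬ IsUnit x → ¬ IsUnit y → ¬ IsUnit (x + y))

  IsField : Set (c ⊔ ℓ)
  IsField = (¬ (1# ≈ 0#)) × (∀ x → ¬ (x ≈ 0#) → IsUnit x)

  IsUnitᵢ : Fin size → Set ℓ
  IsUnitᵢ i = Σ (Fin size) λ j → enum i * enum j ≈ 1#

  isUnitᵢ? : ∀ i → Dec (IsUnitᵢ i)
  isUnitᵢ? i = any? (λ j → (enum i * enum j) ≈? 1#)

  maxIdealSize : ℕ
  maxIdealSize = length (filter (λ i → ¬? (isUnitᵢ? i)) (allFin size))

  CayAdj : ℕ → Fin size → Fin size → Set ℓ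
  CayAdj k i j = Σ (Fin size) λ t → IsUnitᵢ t × ((enum t ^ k) ≈ (enum j - enum i))

  cayAdj? : ∀ k i j → Dec (CayAdj k i j)
  cayAdj? k i j = any? (λ t → isUnitᵢ? t ×-dec ((enum t ^ k) ≈? (enum j - enum i)))

allSubsets : (n : ℕ) → List (Subset n)
allSubsets zero    = [] ∷ []
allSubsets (suc n) = map (outside ∷_) (allSubsets n) ++ map (inside ∷_) (allSubsets n)

IsClique : ∀ {n a} (Adj : Fin n → Fin n → Set a) → Subset n → Set a
IsClique Adj S = ∀ i j → i ∈ S → j ∈ S → i ≢ j → Adj i j

isClique? : ∀ {n a} {Adj : Fin n → Fin n → Set a} →
            (∀ i j → Dec (Adj i j)) → (S : Subset n) → Dec (IsClique Adj S)
isClique? adj? S =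
  all? (λ i → all? (λ j →
    (i ∈? S) →-dec ((j ∈? S) →-dec (¬? (i FinP.≟ j) →-dec adj? i j))))

cliqueCount : ∀ {n a} {Adj : Fin n → Fin n → Set a} →
              (∀ i j → Dec (Adj i j)) → ℕ → ℕ
cliqueCount {n} adj? ℓ =
  length (filter (λ S → (∣ S ∣ Data.Nat.≟ ℓ) ×-dec isClique? adj? S) (allSubsets n))
  where import Data.Nat

𝒦 : ∀ {c ℓ'} (R : FiniteCommRing c ℓ') (k ℓ : ℕ) → ℕ
𝒦 R k ℓ = cliqueCount (cayAdj? R k) ℓ

-- surjective ring homomorphism φ : R → F whose kernel is exactly the set of
-- non-units of R (= the maximal ideal 𝔪 of the local ring R); i.e. F ≅ R/𝔪.
IsResidueMap : ∀ {c₁ ℓ₁ c₂ ℓ₂} (R : FiniteCommRing c₁ ℓ₁) (F : FiniteCommRing c₂ ℓ₂) →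
               (FiniteCommRing.Carrier R → FiniteCommRing.Carrier F) → Set (c₁ ⊔ ℓ₁ ⊔ c₂ ⊔ ℓ₂)
IsResidueMap R F φ =
  IsRingHomomorphism (FiniteCommRing.rawRing R) (FiniteCommRing.rawRing F) φ ×
  (∀ y → ∃ λ x → FiniteCommRing._≈_ F (φ x) y) ×
  (∀ x → (FiniteCommRing._≈_ F (φ x) (FiniteCommRing.0# F) → ¬ IsUnit R x) ×
         (¬ IsUnit R x → FiniteCommRing._≈_ F (φ x) (FiniteCommRing.0# F)))

{-# OPTIONS --safe #-}

-- Reduction modulo 𝔪 maps G_R(k) onto Γ(k,q), and every fibre is a coset of 𝔪, of size m.
-- The map preserves and reflects adjacency: as (k,q) = 1, k is a unit of R, so x ↦ x ^ k is
-- injective, hence bijective, on the finite group 1 + 𝔪; thus any lift x of a k-th root of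
-- the residue of d can be corrected by a k-th root of the principal unit d x⁻ᵏ. Since Γ(k,q)
-- has no loops, a clique of G_R(k) maps injectively onto a clique of Γ(k,q), and the ℓ-cliques
-- over a given ℓ-clique T are exactly the transversals of the fibres over T: m ^ ℓ of them.

module Submission where

module IndicatorSums where

  open import Level using (Level)
  open import Data.Bool using (if_then_else_)
  open import Data.Nat using (ℕ; zero; suc; _+_; _*_)
  open import Data.Nat.Properties
    using (+-0-commutativeMonoid; +-commutativeSemigroup; +-assoc; *-comm; *-zeroʳ; *-distribˡ-+)
  open import Data.Fin using (Fin; zero; suc)
  open import Data.List using (List; []; _∷_; _++_; map; filter; length; tabulate)
  open import Data.Empty using (⊥-elim)
  open import Relation.Nullary using (Dec; yes; no; does)
  open import Relation.Nullary.Decidable using (_×-dec_)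
  open import Relation.Binary.PropositionalEquality
  open import Function using (_∘_; _⇔_; Equivalence)
  open import Algebra.Properties.CommutativeMonoid.Sum +-0-commutativeMonoid using (sum)
  open import Algebra.Properties.CommutativeSemigroup +-commutativeSemigroup
    using () renaming (interchange to +-interchange)

  private
    variable
      a b p q : Level
      A : Set a
      B : Set b
      P : Set p
      Q : Set q

  𝟙 : Dec P → ℕ
  𝟙 P? = if does P? then 1 else 0

  𝟙-cong : P ⇔ Q → (P? : Dec P) (Q? : Dec Q) → 𝟙 P? ≡ 𝟙 Q?
  𝟙-cong P⇔Q (yes p) (yes q) = refl
  𝟙-cong P⇔Q (yes p) (no ¬q) = ⊥-elim (¬q (Equivalence.to P⇔Q p))
  𝟙-cong P⇔Q (no ¬p) (yes q) = ⊥-elim (¬p (Equivalence.from P⇔Q q))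
  𝟙-cong P⇔Q (no ¬p) (no ¬q) = refl

  𝟙-× : (P? : Dec P) (Q? : Dec Q) → 𝟙 (P? ×-dec Q?) ≡ 𝟙 P? * 𝟙 Q?
  𝟙-× (yes p) (yes q) = refl
  𝟙-× (yes p) (no ¬q) = refl
  𝟙-× (no ¬p) Q?      = refl

  ∑ : List A → (A → ℕ) → ℕ
  ∑ []       f = 0
  ∑ (x ∷ xs) f = f x + ∑ xs f

  ∑-cong : ∀ (xs : List A) {f g : A → ℕ} → (∀ x → f x ≡ g x) → ∑ xs f ≡ ∑ xs g
  ∑-cong []       f≗g = refl
  ∑-cong (x ∷ xs) f≗g = cong₂ _+_ (f≗g x) (∑-cong xs f≗g)

  ∑-zero : ∀ (xs : List A) {f : A → ℕ} → (∀ x → f x ≡ 0) → ∑ xs f ≡ 0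
  ∑-zero []       f≗0 = refl
  ∑-zero (x ∷ xs) f≗0 = cong₂ _+_ (f≗0 x) (∑-zero xs f≗0)

  ∑-++ : ∀ (xs ys : List A) f → ∑ (xs ++ ys) f ≡ ∑ xs f + ∑ ys f
  ∑-++ []       ys f = refl
  ∑-++ (x ∷ xs) ys f = trans (cong (f x +_) (∑-++ xs ys f)) (sym (+-assoc (f x) _ _))

  ∑-map : ∀ (g : A → B) (xs : List A) f → ∑ (map g xs) f ≡ ∑ xs (f ∘ g)
  ∑-map g []       f = refl
  ∑-map g (x ∷ xs) f = cong (f (g x) +_) (∑-map g xs f)

  ∑-+ : ∀ (xs : List A) f g → ∑ xs (λ x → f x + g x) ≡ ∑ xs f + ∑ xs g
  ∑-+ []       f g = refl
  ∑-+ (x ∷ xs) f g = trans (cong (f x + g x +_) (∑-+ xs f g)) (+-interchange (f x) (g x) _ _)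

  ∑-*ˡ : ∀ (xs : List A) c f → ∑ xs (λ x → c * f x) ≡ c * ∑ xs f
  ∑-*ˡ []       c f = sym (*-zeroʳ c)
  ∑-*ˡ (x ∷ xs) c f = trans (cong (c * f x +_) (∑-*ˡ xs c f)) (sym (*-distribˡ-+ c (f x) _))

  ∑-*ʳ : ∀ (xs : List A) c f → ∑ xs (λ x → f x * c) ≡ ∑ xs f * c
  ∑-*ʳ xs c f = trans (∑-cong xs (λ x → *-comm (f x) c)) (trans (∑-*ˡ xs c f) (*-comm c _))

  ∑-comm : ∀ (xs : List A) (ys : List B) (f : A → B → ℕ) →
           ∑ xs (λ x → ∑ ys (f x)) ≡ ∑ ys (λ y → ∑ xs (λ x → f x y))
  ∑-comm []       ys f = sym (∑-zero ys (λ _ → refl))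
  ∑-comm (x ∷ xs) ys f = trans (cong (∑ ys (f x) +_) (∑-comm xs ys f)) (sym (∑-+ ys (f x) _))

  length-filter≡∑𝟙 : ∀ {P : A → Set p} (P? : ∀ x → Dec (P x)) (xs : List A) →
                      length (filter P? xs) ≡ ∑ xs (𝟙 ∘ P?)
  length-filter≡∑𝟙 P? []       = refl
  length-filter≡∑𝟙 P? (x ∷ xs) with P? x
  ... | yes _ = cong suc (length-filter≡∑𝟙 P? xs)
  ... | no  _ = length-filter≡∑𝟙 P? xs

  ∑-tabulate : ∀ {n} (f : Fin n → A) (g : A → ℕ) → ∑ (tabulate f) g ≡ sum (g ∘ f)
  ∑-tabulate {n = zero}  f g = refl
  ∑-tabulate {n = suc n} f g = cong (g (f zero) +_) (∑-tabulate (f ∘ suc) g)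

module SubsetImages where

  import Data.Bool as Bool
  open import Data.Nat using (suc)
  open import Data.Fin using (Fin; zero; suc)
  open import Data.Fin.Properties using (suc-injective; all?) renaming (_≟_ to _≟ᶠ_)
  open import Data.Fin.Subset using (Subset; _∈_; _∉_; ∣_∣; inside; outside; ⁅_⁆; _∪_; _-_; ⊥)
  open import Data.Fin.Subset.Properties
    using (_∈?_; x∈p∪q⁻; x∈p∪q⁺; x∈⁅x⁆; x∈⁅y⁆⇒x≡y; ∉⊥; ⊆-antisym; p─q⊆p; x∈p∧x≢y⇒x∈p-y; p─⊥≡p;
           ∣⊥∣≡0)
  open import Data.Vec using (_∷_; []; here; there)
  open import Data.Vec.Properties using (≡-dec)
  open import Data.Product using (∃; _×_; _,_; proj₁)
  open import Data.Sum using (inj₁; inj₂)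
  open import Data.Empty using (⊥-elim)
  open import Relation.Nullary using (Dec; yes; no)
  open import Relation.Nullary.Decidable using (_→-dec_; _×-dec_)
  open import Relation.Binary.PropositionalEquality
  open import Function using (_∘_; case_of_; _⇔_; mk⇔; Equivalence)
  open import Function.Construct.Identity using (⇔-id)
  open import Data.Product.Function.NonDependent.Propositional using (_×-⇔_)

  infix 4 _≟ˢ_
  _≟ˢ_ : ∀ {n} → (p q : Subset n) → Dec (p ≡ q)
  _≟ˢ_ = ≡-dec Bool._≟_

  ∈-remove⁻ : ∀ {n} (p : Subset n) (y : Fin n) {x} → x ∈ p - y → x ∈ p × x ≢ y
  ∈-remove⁻ (b ∷ p) zero    (there x∈p-y) = there (p─q⊆p p ⊥ x∈p-y) , λ ()
  ∈-remove⁻ (b ∷ p) (suc y) here          = here , λ ()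
  ∈-remove⁻ (b ∷ p) (suc y) (there x∈p-y) with ∈-remove⁻ p y x∈p-y
  ... | x∈p , x≢y = there x∈p , x≢y ∘ suc-injective

  x∉p-x : ∀ {n} (p : Subset n) (x : Fin n) → x ∉ p - x
  x∉p-x p x x∈p-x with ∈-remove⁻ p x x∈p-x
  ... | _ , x≢x = x≢x refl

  x∈p⇒∣p∣≡1+∣p-x∣ : ∀ {n} (p : Subset n) (x : Fin n) → x ∈ p → ∣ p ∣ ≡ suc ∣ p - x ∣
  x∈p⇒∣p∣≡1+∣p-x∣ (inside  ∷ p) zero    here        = cong (suc ∘ ∣_∣) (sym (p─⊥≡p p))
  x∈p⇒∣p∣≡1+∣p-x∣ (outside ∷ p) (suc x) (there x∈p) = x∈p⇒∣p∣≡1+∣p-x∣ p x x∈p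
  x∈p⇒∣p∣≡1+∣p-x∣ (inside  ∷ p) (suc x) (there x∈p) = cong suc (x∈p⇒∣p∣≡1+∣p-x∣ p x x∈p)

  x∈p⇒⁅x⁆∪[p-x]≡p : ∀ {n} (p : Subset n) (x : Fin n) → x ∈ p → ⁅ x ⁆ ∪ (p - x) ≡ p
  x∈p⇒⁅x⁆∪[p-x]≡p p x x∈p = ⊆-antisym ⊆p p⊆
    where
    ⊆p : ∀ {y} → y ∈ ⁅ x ⁆ ∪ (p - x) → y ∈ p
    ⊆p y∈ with x∈p∪q⁻ ⁅ x ⁆ (p - x) y∈
    ... | inj₁ y∈⁅x⁆ = subst (_∈ p) (sym (x∈⁅y⁆⇒x≡y x y∈⁅x⁆)) x∈p
    ... | inj₂ y∈p-x = proj₁ (∈-remove⁻ p x y∈p-x)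
    p⊆ : ∀ {y} → y ∈ p → y ∈ ⁅ x ⁆ ∪ (p - x)
    p⊆ {y} y∈p with y ≟ᶠ x
    ... | yes refl = x∈p∪q⁺ (inj₁ (x∈⁅x⁆ x))
    ... | no  y≢x  = x∈p∪q⁺ (inj₂ (x∈p∧x≢y⇒x∈p-y y∈p y≢x))

  x∉p⇒[⁅x⁆∪p]-x≡p : ∀ {n} (p : Subset n) (x : Fin n) → x ∉ p → (⁅ x ⁆ ∪ p) - x ≡ p
  x∉p⇒[⁅x⁆∪p]-x≡p p x x∉p = ⊆-antisym ⊆p p⊆
    where
    ⊆p : ∀ {y} → y ∈ (⁅ x ⁆ ∪ p) - x → y ∈ p
    ⊆p y∈ with ∈-remove⁻ (⁅ x ⁆ ∪ p) x y∈
    ... | y∈⁅x⁆∪p , y≢x with x∈p∪q⁻ ⁅ x ⁆ p y∈⁅x⁆∪p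
    ...   | inj₁ y∈⁅x⁆ = ⊥-elim (y≢x (x∈⁅y⁆⇒x≡y x y∈⁅x⁆))
    ...   | inj₂ y∈p   = y∈p
    p⊆ : ∀ {y} → y ∈ p → y ∈ (⁅ x ⁆ ∪ p) - x
    p⊆ y∈p = x∈p∧x≢y⇒x∈p-y (x∈p∪q⁺ (inj₂ y∈p)) λ { refl → x∉p y∈p }

  image : ∀ {n m} → (Fin n → Fin m) → Subset n → Subset m
  image π []            = ⊥
  image π (outside ∷ S) = image (π ∘ suc) S
  image π (inside  ∷ S) = ⁅ π zero ⁆ ∪ image (π ∘ suc) S

  ∈-image⁺ : ∀ {n m} (π : Fin n → Fin m) (S : Subset n) {i} → i ∈ S → π i ∈ image π S
  ∈-image⁺ π (inside  ∷ S) here        = x∈p∪q⁺ (inj₁ (x∈⁅x⁆ (π zero)))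
  ∈-image⁺ π (outside ∷ S) (there i∈S) = ∈-image⁺ (π ∘ suc) S i∈S
  ∈-image⁺ π (inside  ∷ S) (there i∈S) = x∈p∪q⁺ (inj₂ (∈-image⁺ (π ∘ suc) S i∈S))

  ∈-image⁻ : ∀ {n m} (π : Fin n → Fin m) (S : Subset n) {y} → y ∈ image π S → ∃ λ i → i ∈ S × π i ≡ y
  ∈-image⁻ π []            y∈ = ⊥-elim (∉⊥ y∈)
  ∈-image⁻ π (outside ∷ S) y∈ with ∈-image⁻ (π ∘ suc) S y∈
  ... | i , i∈S , πi≡y = suc i , there i∈S , πi≡y
  ∈-image⁻ π (inside  ∷ S) y∈ with x∈p∪q⁻ ⁅ π zero ⁆ (image (π ∘ suc) S) y∈
  ... | inj₁ y∈⁅π0⁆ = zero , here , sym (x∈⁅y⁆⇒x≡y _ y∈⁅π0⁆)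
  ... | inj₂ y∈I with ∈-image⁻ (π ∘ suc) S y∈I
  ...   | i , i∈S , πi≡y = suc i , there i∈S , πi≡y

  InjectiveOn : ∀ {n m} → (Fin n → Fin m) → Subset n → Set
  InjectiveOn π S = ∀ i j → i ∈ S → j ∈ S → π i ≡ π j → i ≡ j

  injectiveOn? : ∀ {n m} (π : Fin n → Fin m) (S : Subset n) → Dec (InjectiveOn π S)
  injectiveOn? π S = all? λ i → all? λ j →
    (i ∈? S) →-dec ((j ∈? S) →-dec ((π i ≟ᶠ π j) →-dec (i ≟ᶠ j)))

  module _ {n m} (π : Fin (suc n) → Fin m) (S : Subset n) where

    private
      injective-tail : ∀ {b} → InjectiveOn π (b ∷ S) → InjectiveOn (π ∘ suc) S
      injective-tail inj i j i∈S j∈S πi≡πj = suc-injective (inj (suc i) (suc j) (there i∈S) (there j∈S) πi≡πj)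

    injectiveOn-outside : InjectiveOn π (outside ∷ S) ⇔ InjectiveOn (π ∘ suc) S
    injectiveOn-outside = mk⇔ injective-tail from
      where
      from : InjectiveOn (π ∘ suc) S → InjectiveOn π (outside ∷ S)
      from inj (suc i) (suc j) (there i∈S) (there j∈S) πi≡πj = cong suc (inj i j i∈S j∈S πi≡πj)

    injectiveOn-inside : InjectiveOn π (inside ∷ S) ⇔ (InjectiveOn (π ∘ suc) S × π zero ∉ image (π ∘ suc) S)
    injectiveOn-inside = mk⇔ to from
      where
      I = image (π ∘ suc) S
      to : InjectiveOn π (inside ∷ S) → InjectiveOn (π ∘ suc) S × π zero ∉ I
      to inj = injective-tail inj , λ π0∈I →
        let (i , i∈S , πi≡π0) = ∈-image⁻ (π ∘ suc) S π0∈I in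
        case inj (suc i) zero (there i∈S) here πi≡π0 of λ ()
      from : InjectiveOn (π ∘ suc) S × π zero ∉ I → InjectiveOn π (inside ∷ S)
      from (inj , π0∉I) zero    zero    _           _           _     = refl
      from (inj , π0∉I) zero    (suc j) _           (there j∈S) π0≡πj =
        ⊥-elim (π0∉I (subst (_∈ I) (sym π0≡πj) (∈-image⁺ (π ∘ suc) S j∈S)))
      from (inj , π0∉I) (suc i) zero    (there i∈S) _           πi≡π0 =
        ⊥-elim (π0∉I (subst (_∈ I) πi≡π0 (∈-image⁺ (π ∘ suc) S i∈S)))
      from (inj , π0∉I) (suc i) (suc j) (there i∈S) (there j∈S) πi≡πj = cong suc (inj i j i∈S j∈S πi≡πj)

  injectiveOn⇒∣image∣≡∣S∣ : ∀ {n m} (π : Fin n → Fin m) (S : Subset n) →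
                           InjectiveOn π S → ∣ image π S ∣ ≡ ∣ S ∣
  injectiveOn⇒∣image∣≡∣S∣ {m = m} π [] _ = ∣⊥∣≡0 m
  injectiveOn⇒∣image∣≡∣S∣ π (outside ∷ S) inj =
    injectiveOn⇒∣image∣≡∣S∣ (π ∘ suc) S (Equivalence.to (injectiveOn-outside π S) inj)
  injectiveOn⇒∣image∣≡∣S∣ π (inside  ∷ S) inj with Equivalence.to (injectiveOn-inside π S) inj
  ... | inj′ , π0∉I = begin
    ∣ ⁅ a ⁆ ∪ I ∣           ≡⟨ x∈p⇒∣p∣≡1+∣p-x∣ (⁅ a ⁆ ∪ I) a (x∈p∪q⁺ (inj₁ (x∈⁅x⁆ a))) ⟩
    suc ∣ (⁅ a ⁆ ∪ I) - a ∣ ≡⟨ cong (suc ∘ ∣_∣) (x∉p⇒[⁅x⁆∪p]-x≡p I a π0∉I) ⟩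
    suc ∣ I ∣               ≡⟨ cong suc (injectiveOn⇒∣image∣≡∣S∣ (π ∘ suc) S inj′) ⟩
    suc ∣ S ∣               ∎
    where
    open ≡-Reasoning
    a = π zero
    I = image (π ∘ suc) S

  Transversal : ∀ {n m} → (Fin n → Fin m) → Subset m → Subset n → Set
  Transversal π T S = InjectiveOn π S × image π S ≡ T

  transversal? : ∀ {n m} (π : Fin n → Fin m) (T : Subset m) (S : Subset n) → Dec (Transversal π T S)
  transversal? π T S = injectiveOn? π S ×-dec (image π S ≟ˢ T)

  module _ {n m} (π : Fin (suc n) → Fin m) (T : Subset m) (S : Subset n) where

    transversal-outside : Transversal π T (outside ∷ S) ⇔ Transversal (π ∘ suc) T S
    transversal-outside = injectiveOn-outside π S ×-⇔ ⇔-id _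

    transversal-inside : Transversal π T (inside ∷ S) ⇔ (π zero ∈ T × Transversal (π ∘ suc) (T - π zero) S)
    transversal-inside = mk⇔ to from
      where
      a = π zero
      I = image (π ∘ suc) S
      to : InjectiveOn π (inside ∷ S) × ⁅ a ⁆ ∪ I ≡ T → a ∈ T × InjectiveOn (π ∘ suc) S × I ≡ T - a
      to (inj , refl) with Equivalence.to (injectiveOn-inside π S) inj
      ... | inj′ , a∉I = x∈p∪q⁺ (inj₁ (x∈⁅x⁆ a)) , inj′ , sym (x∉p⇒[⁅x⁆∪p]-x≡p I a a∉I)
      from : a ∈ T × InjectiveOn (π ∘ suc) S × I ≡ T - a → InjectiveOn π (inside ∷ S) × ⁅ a ⁆ ∪ I ≡ T
      from (a∈T , inj′ , I≡T-a) =
        Equivalence.from (injectiveOn-inside π S) (inj′ , subst (a ∉_) (sym I≡T-a) (x∉p-x T a)) ,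
        trans (cong (⁅ a ⁆ ∪_) I≡T-a) (x∈p⇒⁅x⁆∪[p-x]≡p T a a∈T)

module Transversals where

  open IndicatorSums
  open SubsetImages
  open import Defs using (allSubsets)
  open import Data.Nat using (ℕ; zero; suc; _+_; _*_; _^_)
  open import Data.Nat.Properties using (+-0-commutativeMonoid; +-comm; +-identityʳ; *-identityˡ; *-assoc)
  open import Data.Nat.Tactic.RingSolver using (solve-∀)
  open import Data.Fin using (Fin; zero; suc)
  open import Data.Fin.Properties using () renaming (_≟_ to _≟ᶠ_)
  open import Data.Fin.Subset using (Subset; ∣_∣; inside; outside; _─_; _-_; ⊥)
  open import Data.Fin.Subset.Properties using (_∈?_; p─⊥≡p)
  open import Data.Vec using (_∷_; [])
  open import Data.List using (map)
  open import Data.Product using (_,_; proj₂)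
  open import Relation.Nullary.Decidable using (_×-dec_)
  open import Relation.Binary.PropositionalEquality
  open import Function using (_∘_; mk⇔)
  open import Algebra.Properties.CommutativeMonoid.Sum +-0-commutativeMonoid using (sum)

  ∑-allSubsets-suc : ∀ n (f : Subset (suc n) → ℕ) →
    ∑ (allSubsets (suc n)) f ≡ ∑ (allSubsets n) (f ∘ (outside ∷_)) + ∑ (allSubsets n) (f ∘ (inside ∷_))
  ∑-allSubsets-suc n f = trans (∑-++ (map (outside ∷_) (allSubsets n)) _ f)
    (cong₂ _+_ (∑-map (outside ∷_) (allSubsets n) f) (∑-map (inside ∷_) (allSubsets n) f))

  ∑-allSubsets-δ : ∀ n (T₀ : Subset n) (f : Subset n → ℕ) →
                   ∑ (allSubsets n) (λ T → 𝟙 (T₀ ≟ˢ T) * f T) ≡ f T₀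
  ∑-allSubsets-δ zero    []             f = trans (+-identityʳ _) (*-identityˡ (f []))
  ∑-allSubsets-δ (suc n) (outside ∷ T₀) f = trans (∑-allSubsets-suc n _)
    (trans (cong₂ _+_ (∑-allSubsets-δ n T₀ (f ∘ (outside ∷_))) (∑-zero (allSubsets n) λ _ → refl)) (+-identityʳ _))
  ∑-allSubsets-δ (suc n) (inside  ∷ T₀) f = trans (∑-allSubsets-suc n _)
    (cong₂ _+_ (∑-zero (allSubsets n) λ _ → refl) (∑-allSubsets-δ n T₀ (f ∘ (inside ∷_))))

  ∏ : ∀ {n} → Subset n → (Fin n → ℕ) → ℕ
  ∏ []            f = 1
  ∏ (outside ∷ T) f = ∏ T (f ∘ suc)
  ∏ (inside  ∷ T) f = f zero * ∏ T (f ∘ suc)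

  ∏-cong : ∀ {n} (T : Subset n) {f g : Fin n → ℕ} → (∀ b → f b ≡ g b) → ∏ T f ≡ ∏ T g
  ∏-cong []            f≗g = refl
  ∏-cong (outside ∷ T) f≗g = ∏-cong T (f≗g ∘ suc)
  ∏-cong (inside  ∷ T) f≗g = cong₂ _*_ (f≗g zero) (∏-cong T (f≗g ∘ suc))

  ∏-const : ∀ {n} (T : Subset n) c → ∏ T (λ _ → c) ≡ c ^ ∣ T ∣
  ∏-const []            c = refl
  ∏-const (outside ∷ T) c = ∏-const T c
  ∏-const (inside  ∷ T) c = cong (c *_) (∏-const T c)

  ∏-zero : ∀ {n} (T : Subset n) → ∏ T (λ _ → 0) ≡ 𝟙 (⊥ ≟ˢ T)
  ∏-zero []            = refl
  ∏-zero (outside ∷ T) = ∏-zero T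
  ∏-zero (inside  ∷ T) = refl

  ∏-δ+ : ∀ {n} (T : Subset n) (a : Fin n) (f : Fin n → ℕ) →
         ∏ T (λ b → 𝟙 (a ≟ᶠ b) + f b) ≡ ∏ T f + 𝟙 (a ∈? T) * ∏ (T - a) f
  ∏-δ+ (outside ∷ T) zero    f = sym (+-identityʳ _)
  ∏-δ+ (inside  ∷ T) zero    f = begin
    ∏ T f′ + f zero * ∏ T f′          ≡⟨ +-comm (∏ T f′) _ ⟩
    f zero * ∏ T f′ + ∏ T f′          ≡⟨ cong (λ U → f zero * ∏ T f′ + ∏ U f′) (p─⊥≡p T) ⟨
    f zero * ∏ T f′ + ∏ (T ─ ⊥) f′    ≡⟨ cong (f zero * ∏ T f′ +_) (*-identityˡ _) ⟨
    f zero * ∏ T f′ + 1 * ∏ (T ─ ⊥) f′ ∎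
    where
    open ≡-Reasoning
    f′ = f ∘ suc
  ∏-δ+ (outside ∷ T) (suc a) f = ∏-δ+ T a (f ∘ suc)
  ∏-δ+ (inside  ∷ T) (suc a) f =
    trans (cong (f zero *_) (∏-δ+ T a (f ∘ suc))) (distrib (f zero) (∏ T (f ∘ suc)) (𝟙 (a ∈? T)) _)
    where
    distrib : ∀ x p i q → x * (p + i * q) ≡ x * p + i * (x * q)
    distrib = solve-∀

  fibre : ∀ {n m} → (Fin n → Fin m) → Fin m → ℕ
  fibre π b = sum (λ i → 𝟙 (π i ≟ᶠ b))

  ∑-transversals : ∀ n {m} (π : Fin n → Fin m) (T : Subset m) →
                   ∑ (allSubsets n) (𝟙 ∘ transversal? π T) ≡ ∏ T (fibre π)
  ∑-transversals zero π T = begin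
    𝟙 (transversal? π T []) + 0 ≡⟨ +-identityʳ _ ⟩
    𝟙 (transversal? π T [])     ≡⟨ 𝟙-cong (mk⇔ proj₂ ((λ ()) ,_)) (transversal? π T []) (⊥ ≟ˢ T) ⟩
    𝟙 (⊥ ≟ˢ T)                  ≡⟨ ∏-zero T ⟨
    ∏ T (fibre π)               ∎
    where open ≡-Reasoning
  ∑-transversals (suc n) π T = begin
    ∑ (allSubsets (suc n)) (𝟙 ∘ transversal? π T)
      ≡⟨ ∑-allSubsets-suc n (𝟙 ∘ transversal? π T) ⟩
    ∑ Sₙ (λ S → 𝟙 (transversal? π T (outside ∷ S))) + ∑ Sₙ (λ S → 𝟙 (transversal? π T (inside ∷ S)))
      ≡⟨ cong₂ _+_ (∑-cong Sₙ outside-term) (∑-cong Sₙ inside-term) ⟩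
    ∑ Sₙ (𝟙 ∘ transversal? π′ T) + ∑ Sₙ (λ S → 𝟙 (a ∈? T) * 𝟙 (transversal? π′ (T - a) S))
      ≡⟨ cong (∑ Sₙ (𝟙 ∘ transversal? π′ T) +_) (∑-*ˡ Sₙ (𝟙 (a ∈? T)) (𝟙 ∘ transversal? π′ (T - a))) ⟩
    ∑ Sₙ (𝟙 ∘ transversal? π′ T) + 𝟙 (a ∈? T) * ∑ Sₙ (𝟙 ∘ transversal? π′ (T - a))
      ≡⟨ cong₂ (λ x y → x + 𝟙 (a ∈? T) * y) (∑-transversals n π′ T) (∑-transversals n π′ (T - a)) ⟩
    ∏ T (fibre π′) + 𝟙 (a ∈? T) * ∏ (T - a) (fibre π′)
      ≡⟨ ∏-δ+ T a (fibre π′) ⟨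
    ∏ T (fibre π) ∎
    where
    open ≡-Reasoning
    Sₙ = allSubsets n
    a  = π zero
    π′ = π ∘ suc
    outside-term : ∀ S → 𝟙 (transversal? π T (outside ∷ S)) ≡ 𝟙 (transversal? π′ T S)
    outside-term S = 𝟙-cong (transversal-outside π T S) (transversal? π T (outside ∷ S)) (transversal? π′ T S)
    inside-term : ∀ S → 𝟙 (transversal? π T (inside ∷ S)) ≡ 𝟙 (a ∈? T) * 𝟙 (transversal? π′ (T - a) S)
    inside-term S = trans
      (𝟙-cong (transversal-inside π T S) (transversal? π T (inside ∷ S)) ((a ∈? T) ×-dec transversal? π′ (T - a) S))
      (𝟙-× (a ∈? T) (transversal? π′ (T - a) S))

  ∑-injectiveOn-image : ∀ n {m} (π : Fin n → Fin m) (g : Subset m → ℕ) →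
    ∑ (allSubsets n) (λ S → 𝟙 (injectiveOn? π S) * g (image π S)) ≡ ∑ (allSubsets m) (λ T → ∏ T (fibre π) * g T)
  ∑-injectiveOn-image n {m} π g = begin
    ∑ Sₙ (λ S → 𝟙 (injectiveOn? π S) * g (image π S))        ≡⟨ ∑-cong Sₙ split-by-image ⟩
    ∑ Sₙ (λ S → ∑ Sₘ (λ T → 𝟙 (transversal? π T S) * g T))   ≡⟨ ∑-comm Sₙ Sₘ _ ⟩
    ∑ Sₘ (λ T → ∑ Sₙ (λ S → 𝟙 (transversal? π T S) * g T))   ≡⟨ ∑-cong Sₘ count-transversals ⟩
    ∑ Sₘ (λ T → ∏ T (fibre π) * g T)                          ∎
    where
    open ≡-Reasoning
    Sₙ = allSubsets n
    Sₘ = allSubsets m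
    split-by-image : ∀ S → 𝟙 (injectiveOn? π S) * g (image π S) ≡ ∑ Sₘ (λ T → 𝟙 (transversal? π T S) * g T)
    split-by-image S = begin
      i * g (image π S)                            ≡⟨ cong (i *_) (∑-allSubsets-δ m (image π S) g) ⟨
      i * ∑ Sₘ (λ T → 𝟙 (image π S ≟ˢ T) * g T)    ≡⟨ ∑-*ˡ Sₘ i (λ T → 𝟙 (image π S ≟ˢ T) * g T) ⟨
      ∑ Sₘ (λ T → i * (𝟙 (image π S ≟ˢ T) * g T))  ≡⟨ ∑-cong Sₘ (λ T → *-assoc i _ (g T)) ⟨
      ∑ Sₘ (λ T → i * 𝟙 (image π S ≟ˢ T) * g T)    ≡⟨ ∑-cong Sₘ (λ T → cong (_* g T) (𝟙-× inj? (image π S ≟ˢ T))) ⟨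
      ∑ Sₘ (λ T → 𝟙 (transversal? π T S) * g T)    ∎
      where
      inj? = injectiveOn? π S
      i    = 𝟙 inj?
    count-transversals : ∀ T → ∑ Sₙ (λ S → 𝟙 (transversal? π T S) * g T) ≡ ∏ T (fibre π) * g T
    count-transversals T = trans (∑-*ʳ Sₙ (g T) (𝟙 ∘ transversal? π T)) (cong (_* g T) (∑-transversals n π T))

module Cliques where

  open IndicatorSums
  open SubsetImages
  open Transversals
  open import Defs using (allSubsets; IsClique; isClique?; cliqueCount)
  open import Data.Nat using (ℕ; _*_; _^_) renaming (_≟_ to _≟ℕ_)
  open import Data.Nat.Properties using (*-comm; *-zeroʳ)
  open import Data.Fin using (Fin)
  open import Data.Fin.Properties using () renaming (_≟_ to _≟ᶠ_)
  open import Data.Fin.Subset using (∣_∣)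
  open import Data.List using (filter; length)
  open import Data.Product using (_×_; _,_)
  open import Data.Empty using (⊥-elim)
  open import Relation.Nullary using (¬_; Dec; yes; no)
  open import Relation.Nullary.Decidable using (_×-dec_)
  open import Relation.Binary.PropositionalEquality
  open import Function using (_∘_; _⇔_; mk⇔; Equivalence)

  module _ {n m a b} {AdjG : Fin n → Fin n → Set a} {AdjH : Fin m → Fin m → Set b}
           (π : Fin n → Fin m)
           (π-adj : ∀ i j → AdjG i j ⇔ AdjH (π i) (π j))
           (H-irreflexive : ∀ x → ¬ AdjH x x) where

    isClique⇔ : ∀ S → IsClique AdjG S ⇔ (InjectiveOn π S × IsClique AdjH (image π S))
    isClique⇔ S = mk⇔ to from
      where
      to : IsClique AdjG S → InjectiveOn π S × IsClique AdjH (image π S)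
      to clique = injective , image-clique
        where
        injective : InjectiveOn π S
        injective i j i∈S j∈S πi≡πj with i ≟ᶠ j
        ... | yes i≡j = i≡j
        ... | no  i≢j = ⊥-elim (H-irreflexive (π j)
                          (subst (λ x → AdjH x (π j)) πi≡πj (Equivalence.to (π-adj i j) (clique i j i∈S j∈S i≢j))))
        image-clique : IsClique AdjH (image π S)
        image-clique x y x∈ y∈ x≢y with ∈-image⁻ π S x∈ | ∈-image⁻ π S y∈
        ... | i , i∈S , refl | j , j∈S , refl = Equivalence.to (π-adj i j) (clique i j i∈S j∈S (x≢y ∘ cong π))
      from : InjectiveOn π S × IsClique AdjH (image π S) → IsClique AdjG S
      from (injective , image-clique) i j i∈S j∈S i≢j = Equivalence.from (π-adj i j)
        (image-clique (π i) (π j) (∈-image⁺ π S i∈S) (∈-image⁺ π S j∈S) (i≢j ∘ injective i j i∈S j∈S))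

    module _ {adjG? : ∀ i j → Dec (AdjG i j)} {adjH? : ∀ x y → Dec (AdjH x y)}
             {c : ℕ} (fibre≡c : ∀ y → fibre π y ≡ c) where

      cliqueCount-blowUp : ∀ ℓ → cliqueCount adjG? ℓ ≡ cliqueCount adjH? ℓ * c ^ ℓ
      cliqueCount-blowUp ℓ = begin
        length (filter ℓ-cliqueG? Sₙ)
          ≡⟨ length-filter≡∑𝟙 ℓ-cliqueG? Sₙ ⟩
        ∑ Sₙ (𝟙 ∘ ℓ-cliqueG?)
          ≡⟨ ∑-cong Sₙ via-image ⟩
        ∑ Sₙ (λ S → 𝟙 (injectiveOn? π S) * 𝟙 (ℓ-cliqueH? (image π S)))
          ≡⟨ ∑-injectiveOn-image n π (𝟙 ∘ ℓ-cliqueH?) ⟩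
        ∑ Sₘ (λ T → ∏ T (fibre π) * 𝟙 (ℓ-cliqueH? T))
          ≡⟨ ∑-cong Sₘ weight-on-ℓ-sets ⟩
        ∑ Sₘ (λ T → 𝟙 (ℓ-cliqueH? T) * c ^ ℓ)
          ≡⟨ ∑-*ʳ Sₘ (c ^ ℓ) (𝟙 ∘ ℓ-cliqueH?) ⟩
        ∑ Sₘ (𝟙 ∘ ℓ-cliqueH?) * c ^ ℓ
          ≡⟨ cong (_* c ^ ℓ) (length-filter≡∑𝟙 ℓ-cliqueH? Sₘ) ⟨
        length (filter ℓ-cliqueH? Sₘ) * c ^ ℓ
          ∎
        where
        open ≡-Reasoning
        Sₙ = allSubsets n
        Sₘ = allSubsets m
        ℓ-cliqueG? : ∀ S → Dec (∣ S ∣ ≡ ℓ × IsClique AdjG S)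
        ℓ-cliqueG? S = (∣ S ∣ ≟ℕ ℓ) ×-dec isClique? adjG? S
        ℓ-cliqueH? : ∀ T → Dec (∣ T ∣ ≡ ℓ × IsClique AdjH T)
        ℓ-cliqueH? T = (∣ T ∣ ≟ℕ ℓ) ×-dec isClique? adjH? T
        via-image : ∀ S → 𝟙 (ℓ-cliqueG? S) ≡ 𝟙 (injectiveOn? π S) * 𝟙 (ℓ-cliqueH? (image π S))
        via-image S = trans (𝟙-cong (mk⇔ to from) (ℓ-cliqueG? S) (injectiveOn? π S ×-dec ℓ-cliqueH? (image π S)))
                            (𝟙-× (injectiveOn? π S) (ℓ-cliqueH? (image π S)))
          where
          to : ∣ S ∣ ≡ ℓ × IsClique AdjG S → InjectiveOn π S × ∣ image π S ∣ ≡ ℓ × IsClique AdjH (image π S)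
          to (∣S∣≡ℓ , clique) with Equivalence.to (isClique⇔ S) clique
          ... | injective , image-clique =
            injective , trans (injectiveOn⇒∣image∣≡∣S∣ π S injective) ∣S∣≡ℓ , image-clique
          from : InjectiveOn π S × ∣ image π S ∣ ≡ ℓ × IsClique AdjH (image π S) → ∣ S ∣ ≡ ℓ × IsClique AdjG S
          from (injective , ∣image∣≡ℓ , image-clique) =
            trans (sym (injectiveOn⇒∣image∣≡∣S∣ π S injective)) ∣image∣≡ℓ ,
            Equivalence.from (isClique⇔ S) (injective , image-clique)
        weight-on-ℓ-sets : ∀ T → ∏ T (fibre π) * 𝟙 (ℓ-cliqueH? T) ≡ 𝟙 (ℓ-cliqueH? T) * c ^ ℓ
        weight-on-ℓ-sets T = by-size (∣ T ∣ ≟ℕ ℓ)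
          where
          by-size : (d : Dec (∣ T ∣ ≡ ℓ)) →
                    ∏ T (fibre π) * 𝟙 (d ×-dec isClique? adjH? T) ≡ 𝟙 (d ×-dec isClique? adjH? T) * c ^ ℓ
          by-size (no  _)    = *-zeroʳ (∏ T (fibre π))
          by-size (yes refl) = trans (cong (_* _) (trans (∏-cong T fibre≡c) (∏-const T c))) (*-comm (c ^ ∣ T ∣) _)

module FiniteRings where

  open import Defs
  open import Algebra.Bundles using (Semiring)
  open import Data.Nat as ℕ using (ℕ; zero; suc)
  open import Data.Nat.Properties using (n<1+n)
  open import Data.Nat.GCD using (gcd; gcd-GCD; module Bézout)
  open import Data.Fin using (Fin; suc; punchOut)
  open import Data.Fin.Properties using (any?; pigeonhole; punchOut-injective; <⇒≢) renaming (_≟_ to _≟ᶠ_)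
  open import Data.Fin.Permutation using (Permutation′; permutation)
  open import Data.Product using (∃; _×_; _,_; proj₁; proj₂)
  open import Data.Empty using (⊥-elim)
  open import Relation.Nullary using (¬_; Dec; yes; no)
  open import Relation.Nullary.Decidable using (map′; ¬?)
  open import Relation.Binary.PropositionalEquality as ≡ using (_≡_)
  open import Function using (_∘_; _⇔_; mk⇔)
  import Algebra.Definitions.RawSemiring as RawSemiringDefinitions
  import Algebra.Properties.Ring as RingProperties
  import Algebra.Properties.Semiring.Mult as MultProperties
  import Algebra.Properties.Semiring.Exp as ExpProperties
  import Algebra.Properties.CommutativeSemiring.Exp as CommutativeExpProperties
  import Algebra.Properties.CommutativeMonoid.Sum as Sum
  import Algebra.Solver.Ring.NaturalCoefficients.Default as NaturalCoefficients
  import Relation.Binary.Reasoning.Setoid as SetoidReasoning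

  injective⇒surjective : ∀ {n} (f : Fin n → Fin n) → (∀ {i j} → f i ≡ f j → i ≡ j) →
                         ∀ y → ∃ λ x → f x ≡ y
  injective⇒surjective {suc n} f f-inj y with any? (λ x → f x ≟ᶠ y)
  ... | yes hit = hit
  ... | no  miss with pigeonhole (n<1+n n) (λ x → punchOut {i = y} {j = f x} (miss ∘ (x ,_) ∘ ≡.sym))
  ...   | i , j , i<j , same =
    ⊥-elim (<⇒≢ i<j (f-inj (punchOut-injective (miss ∘ (i ,_) ∘ ≡.sym) (miss ∘ (j ,_) ∘ ≡.sym) same)))

  module FiniteRingProperties {c ℓ} (X : FiniteCommRing c ℓ) where

    open FiniteCommRing X
    open RawSemiringDefinitions (Semiring.rawSemiring semiring) public using () renaming (_×_ to _·_)
    open RingProperties ring public using (+-cancelʳ)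
    open RingProperties ring using (//-rightDividesˡ; //-rightDividesʳ)
    open MultProperties semiring using (×1-homo-*)
    open ExpProperties semiring public using (^-congˡ)
    open CommutativeExpProperties commutativeSemiring public using (^-distrib-*)
    open Sum +-commutativeMonoid using (sum; sum-cong-≋; sum-permute; ∑-distrib-+; sum-replicate)
    open SetoidReasoning setoid
    open NaturalCoefficients commutativeSemiring

    index : Carrier → Fin size
    index x = proj₁ (enum-surj x)

    enum-index : ∀ x → enum (index x) ≈ x
    enum-index x = proj₂ (enum-surj x)

    index-cong : ∀ {x y} → x ≈ y → index x ≡ index y
    index-cong {x} {y} x≈y = enum-inj _ _ (trans (enum-index x) (trans x≈y (sym (enum-index y))))

    index-enum : ∀ i → index (enum i) ≡ i
    index-enum i = enum-inj _ _ (enum-index (enum i))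

    index≡⇒≈enum : ∀ {x i} → index x ≡ i → x ≈ enum i
    index≡⇒≈enum {x} eq = trans (sym (enum-index x)) (reflexive (≡.cong enum eq))

    index-injective : ∀ {x y} → index x ≡ index y → x ≈ y
    index-injective {x} {y} eq = trans (index≡⇒≈enum eq) (enum-index y)

    isUnit-resp : ∀ {x y} → x ≈ y → IsUnit X x → IsUnit X y
    isUnit-resp x≈y (x⁻¹ , xx⁻¹≈1) = x⁻¹ , trans (*-cong (sym x≈y) refl) xx⁻¹≈1

    isUnit-* : ∀ {x y} → IsUnit X x → IsUnit X y → IsUnit X (x * y)
    isUnit-* {x} {y} (x⁻¹ , xx⁻¹≈1) (y⁻¹ , yy⁻¹≈1) = x⁻¹ * y⁻¹ , (begin
      (x * y) * (x⁻¹ * y⁻¹) ≈⟨ solve 4 (λ a b c d → (a :* b) :* (c :* d) := (a :* c) :* (b :* d)) refl x y x⁻¹ y⁻¹ ⟩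
      (x * x⁻¹) * (y * y⁻¹) ≈⟨ *-cong xx⁻¹≈1 yy⁻¹≈1 ⟩
      1# * 1#               ≈⟨ *-identityˡ 1# ⟩
      1#                    ∎)

    isUnit-^ : ∀ {x} n → IsUnit X x → IsUnit X (x ^ n)
    isUnit-^ zero    _ = 1# , *-identityˡ 1#
    isUnit-^ (suc n) u = isUnit-* u (isUnit-^ n u)

    IsUnitᵢ⇔IsUnit : ∀ i → IsUnitᵢ X i ⇔ IsUnit X (enum i)
    IsUnitᵢ⇔IsUnit i = mk⇔ (λ (j , p) → enum j , p) (λ (y , p) → index y , trans (*-cong refl (enum-index y)) p)

    isUnit? : ∀ x → Dec (IsUnit X x)
    isUnit? x = map′ (λ (j , p) → enum j , trans (*-cong (sym (enum-index x)) refl) p)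
                     (λ (y , p) → index y , trans (*-cong (enum-index x) (enum-index y)) p)
                     (isUnitᵢ? X (index x))

    isUnit⇒≉0 : ¬ (1# ≈ 0#) → ∀ {x} → IsUnit X x → ¬ (x ≈ 0#)
    isUnit⇒≉0 1≉0 {x} (y , xy≈1) x≈0 = 1≉0 (trans (sym xy≈1) (trans (*-cong x≈0 refl) (zeroˡ y)))

    1#^n≈1# : ∀ n → 1# ^ n ≈ 1#
    1#^n≈1# zero    = refl
    1#^n≈1# (suc n) = trans (*-identityˡ _) (1#^n≈1# n)

    ^-cancel-inverse : ∀ {x y} d n → x * y ≈ 1# → x ^ n * (d * y ^ n) ≈ d
    ^-cancel-inverse {x} {y} d n xy≈1 = begin
      x ^ n * (d * y ^ n)   ≈⟨ solve 3 (λ a d b → a :* (d :* b) := d :* (a :* b)) refl (x ^ n) d (y ^ n) ⟩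
      d * (x ^ n * y ^ n)   ≈⟨ *-cong refl (^-distrib-* x y n) ⟨
      d * (x * y) ^ n       ≈⟨ *-cong refl (trans (^-congˡ n xy≈1) (1#^n≈1# n)) ⟩
      d * 1#                ≈⟨ *-identityʳ d ⟩
      d                     ∎

    translation : Carrier → Permutation′ size
    translation a = permutation (λ i → index (enum i + a)) (λ i → index (enum i - a))
      (λ i → ≡.trans (index-cong (trans (+-cong (enum-index _) refl) (//-rightDividesˡ a (enum i)))) (index-enum i))
      (λ i → ≡.trans (index-cong (trans (+-cong (enum-index _) refl) (//-rightDividesʳ a (enum i)))) (index-enum i))

    size·1#≈0# : size · 1# ≈ 0#
    size·1#≈0# = +-cancelʳ (sum enum) _ _ (begin
      size · 1# + sum enum                    ≈⟨ +-comm _ _ ⟩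
      sum enum + size · 1#                    ≈⟨ +-cong refl (sum-replicate size) ⟨
      sum enum + sum {size} (λ _ → 1#)        ≈⟨ ∑-distrib-+ enum (λ _ → 1#) ⟨
      sum (λ i → enum i + 1#)                 ≈⟨ sum-cong-≋ (λ i → enum-index (enum i + 1#)) ⟨
      sum (λ i → enum (index (enum i + 1#)))  ≈⟨ sum-permute enum (translation 1#) ⟨
      sum enum                                ≈⟨ +-identityˡ _ ⟨
      0# + sum enum                           ∎)

    gcd≡1⇒·1#≉0# : ¬ (1# ≈ 0#) → ∀ k → gcd k size ≡ 1 → ¬ (k · 1# ≈ 0#)
    gcd≡1⇒·1#≉0# 1≉0 k gcd≡1 k·1≈0 =
      1≉0 (from-identity (≡.subst (λ d → Bézout.Identity d k size) gcd≡1 (Bézout.identity (gcd-GCD k size))))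
      where
      multiple-·1#≈0# : ∀ {n} → n · 1# ≈ 0# → ∀ x → (x ℕ.* n) · 1# ≈ 0#
      multiple-·1#≈0# {n} n·1≈0 x = trans (×1-homo-* x n) (trans (*-cong refl n·1≈0) (zeroʳ _))
      1+a≡b⇒1≈0 : ∀ {a b} → suc a ≡ b → a · 1# ≈ 0# → b · 1# ≈ 0# → 1# ≈ 0#
      1+a≡b⇒1≈0 {a} ≡.refl a·1≈0 b·1≈0 = begin
        1#            ≈⟨ +-identityʳ 1# ⟨
        1# + 0#       ≈⟨ +-cong refl a·1≈0 ⟨
        suc a · 1#    ≈⟨ b·1≈0 ⟩
        0#            ∎
      from-identity : Bézout.Identity 1 k size → 1# ≈ 0#
      from-identity (Bézout.+- x y eq) = 1+a≡b⇒1≈0 eq (multiple-·1#≈0# size·1#≈0# y) (multiple-·1#≈0# k·1≈0 x)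
      from-identity (Bézout.-+ x y eq) = 1+a≡b⇒1≈0 eq (multiple-·1#≈0# k·1≈0 x) (multiple-·1#≈0# size·1#≈0# y)

  module LocalRingProperties {c ℓ} (X : FiniteCommRing c ℓ) (local : IsLocal X) where

    open FiniteCommRing X
    open FiniteRingProperties X
    open RingProperties ring
      using (-‿distribˡ-*; -‿distribʳ-*; +-cancelˡ; //-rightDividesˡ; //-rightDividesʳ; ⁻¹-anti-homo‿-)
    open SetoidReasoning setoid
    open NaturalCoefficients commutativeSemiring

    NonUnit : Carrier → Set _
    NonUnit x = ¬ IsUnit X x

    nonUnit-resp : ∀ {x y} → x ≈ y → NonUnit x → NonUnit y
    nonUnit-resp x≈y x∉U y∈U = x∉U (isUnit-resp (sym x≈y) y∈U)

    nonUnit-*ʳ : ∀ {x} y → NonUnit x → NonUnit (x * y)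
    nonUnit-*ʳ {x} y x∉U (z , xyz≈1) = x∉U (y * z , trans (sym (*-assoc x y z)) xyz≈1)

    nonUnit-neg : ∀ {x} → NonUnit x → NonUnit (- x)
    nonUnit-neg {x} x∉U (z , -xz≈1) =
      x∉U (- z , trans (sym (-‿distribʳ-* x z)) (trans (-‿distribˡ-* x z) -xz≈1))

    nonUnit-+ : ∀ {x y} → NonUnit x → NonUnit y → NonUnit (x + y)
    nonUnit-+ = proj₂ local _ _

    nonUnit-sub : ∀ {x y} → NonUnit x → NonUnit y → NonUnit (x - y)
    nonUnit-sub x∉U y∉U = nonUnit-+ x∉U (nonUnit-neg y∉U)

    isUnit-+-nonUnit : ∀ {x y} → IsUnit X x → NonUnit y → IsUnit X (x + y)
    isUnit-+-nonUnit {x} {y} x∈U y∉U with isUnit? (x + y)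
    ... | yes x+y∈U = x+y∈U
    ... | no  x+y∉U = ⊥-elim (nonUnit-resp (//-rightDividesʳ y x) (nonUnit-sub x+y∉U y∉U) x∈U)

    PrincipalUnit : Carrier → Set _
    PrincipalUnit a = NonUnit (a - 1#)

    principalUnit? : ∀ a → Dec (PrincipalUnit a)
    principalUnit? a = ¬? (isUnit? (a - 1#))

    1+[a-1]≈a : ∀ a → 1# + (a - 1#) ≈ a
    1+[a-1]≈a a = trans (+-comm _ _) (//-rightDividesˡ 1# a)

    principalUnit⇒isUnit : ∀ {a} → PrincipalUnit a → IsUnit X a
    principalUnit⇒isUnit {a} a∈1+𝔪 = isUnit-resp (1+[a-1]≈a a) (isUnit-+-nonUnit (1# , *-identityˡ 1#) a∈1+𝔪)

    principalUnit-resp : ∀ {a b} → a ≈ b → PrincipalUnit a → PrincipalUnit b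
    principalUnit-resp a≈b = nonUnit-resp (+-cong a≈b refl)

    [1+n]^i-expansion : ∀ n i → ∃ λ e → (1# + n) ^ i ≈ 1# + n * (i · 1# + n * e)
    [1+n]^i-expansion n zero    = 0# , solve 1 (λ n → con 1 := con 1 :+ n :* (con 0 :+ n :* con 0)) refl n
    [1+n]^i-expansion n (suc i) with [1+n]^i-expansion n i
    ... | e , expand = e + (i · 1# + n * e) , (begin
      (1# + n) * (1# + n) ^ i               ≈⟨ *-cong refl expand ⟩
      (1# + n) * (1# + n * (i · 1# + n * e)) ≈⟨ solve 3 (λ n t e → (con 1 :+ n) :* (con 1 :+ n :* (t :+ n :* e)) :=
                                                                 con 1 :+ n :* ((con 1 :+ t) :+ n :* (e :+ (t :+ n :* e))))
                                                       refl n (i · 1#) e ⟩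
      1# + n * ((1# + i · 1#) + n * (e + (i · 1# + n * e))) ∎)

    module _ (k : ℕ) (k-isUnit : IsUnit X (k · 1#)) where

      ^-principalUnit : ∀ {a} → PrincipalUnit a → PrincipalUnit (a ^ k)
      ^-principalUnit {a} a-1∉U with [1+n]^i-expansion (a - 1#) k
      ... | e , expand = nonUnit-resp (sym a^k-1≈y) (nonUnit-*ʳ _ a-1∉U)
        where
        y = (a - 1#) * (k · 1# + (a - 1#) * e)
        a^k-1≈y : a ^ k - 1# ≈ y
        a^k-1≈y = begin
          a ^ k - 1#               ≈⟨ +-cong (^-congˡ k (1+[a-1]≈a a)) refl ⟨
          (1# + (a - 1#)) ^ k - 1# ≈⟨ +-cong (trans expand (+-comm 1# y)) refl ⟩
          (y + 1#) - 1#            ≈⟨ //-rightDividesʳ 1# y ⟩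
          y                        ∎

      principalUnit-rootOfUnity : ∀ {w} → PrincipalUnit w → w ^ k ≈ 1# → w ≈ 1#
      principalUnit-rootOfUnity {w} n∉U w^k≈1 with [1+n]^i-expansion (w - 1#) k
      ... | e , expand with isUnit-+-nonUnit k-isUnit (nonUnit-*ʳ e n∉U)
      ...   | v , [k+ne]v≈1 = begin
        w        ≈⟨ 1+[a-1]≈a w ⟨
        1# + n   ≈⟨ +-cong refl n≈0 ⟩
        1# + 0#  ≈⟨ +-identityʳ 1# ⟩
        1#       ∎
        where
        n = w - 1#
        n[k+ne]≈0 : n * (k · 1# + n * e) ≈ 0#
        n[k+ne]≈0 = +-cancelˡ 1# _ _ (begin
          1# + n * (k · 1# + n * e) ≈⟨ expand ⟨
          (1# + n) ^ k              ≈⟨ ^-congˡ k (1+[a-1]≈a w) ⟩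
          w ^ k                     ≈⟨ w^k≈1 ⟩
          1#                        ≈⟨ +-identityʳ 1# ⟨
          1# + 0#                   ∎)
        n≈0 : n ≈ 0#
        n≈0 = begin
          n                             ≈⟨ *-identityʳ n ⟨
          n * 1#                        ≈⟨ *-cong refl [k+ne]v≈1 ⟨
          n * ((k · 1# + n * e) * v)    ≈⟨ *-assoc n _ v ⟨
          (n * (k · 1# + n * e)) * v    ≈⟨ *-cong n[k+ne]≈0 refl ⟩
          0# * v                        ≈⟨ zeroˡ v ⟩
          0#                            ∎

      ^-injectiveOn-principalUnits : ∀ {a b} → PrincipalUnit a → PrincipalUnit b → a ^ k ≈ b ^ k → a ≈ b
      ^-injectiveOn-principalUnits {a} {b} a-1∉U b-1∉U a^k≈b^k with principalUnit⇒isUnit b-1∉U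
      ... | c , bc≈1 = begin
        a            ≈⟨ *-identityʳ a ⟨
        a * 1#       ≈⟨ *-cong refl bc≈1 ⟨
        a * (b * c)  ≈⟨ solve 3 (λ a b c → a :* (b :* c) := (a :* c) :* b) refl a b c ⟩
        (a * c) * b  ≈⟨ *-cong ac≈1 refl ⟩
        1# * b       ≈⟨ *-identityˡ b ⟩
        b            ∎
        where
        a-b∉U : NonUnit (a - b)
        a-b∉U = nonUnit-resp (begin
          (a - 1#) + - (b - 1#)  ≈⟨ +-cong refl (⁻¹-anti-homo‿- b 1#) ⟩
          (a - 1#) + (1# - b)    ≈⟨ +-assoc (a - 1#) 1# (- b) ⟨
          ((a - 1#) + 1#) - b    ≈⟨ +-cong (//-rightDividesˡ 1# a) refl ⟩
          a - b                  ∎) (nonUnit-sub a-1∉U b-1∉U)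
        ac-1∉U : PrincipalUnit (a * c)
        ac-1∉U = nonUnit-resp (begin
          (a - b) * c       ≈⟨ distribʳ c a (- b) ⟩
          a * c + - b * c   ≈⟨ +-cong refl (-‿distribˡ-* b c) ⟨
          a * c - b * c     ≈⟨ +-cong refl (-‿cong bc≈1) ⟩
          a * c - 1#        ∎) (nonUnit-*ʳ c a-b∉U)
        ac≈1 : a * c ≈ 1#
        ac≈1 = principalUnit-rootOfUnity ac-1∉U (begin
          (a * c) ^ k     ≈⟨ ^-distrib-* a c k ⟩
          a ^ k * c ^ k   ≈⟨ *-cong a^k≈b^k refl ⟩
          b ^ k * c ^ k   ≈⟨ ^-distrib-* b c k ⟨
          (b * c) ^ k     ≈⟨ ^-congˡ k bc≈1 ⟩
          1# ^ k          ≈⟨ 1#^n≈1# k ⟩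
          1#              ∎)

      -- x ↦ x ^ k on 1 + 𝔪, extended by the identity elsewhere so that it is a self-map of Fin size.
      powerOnPrincipalUnits : Fin size → Fin size
      powerOnPrincipalUnits i with principalUnit? (enum i)
      ... | yes _ = index (enum i ^ k)
      ... | no  _ = i

      powerOnPrincipalUnits-injective : ∀ {i j} → powerOnPrincipalUnits i ≡ powerOnPrincipalUnits j → i ≡ j
      powerOnPrincipalUnits-injective {i} {j} eq with principalUnit? (enum i) | principalUnit? (enum j)
      ... | yes i∈ | yes j∈ = enum-inj i j (^-injectiveOn-principalUnits i∈ j∈ (index-injective eq))
      ... | yes i∈ | no  j∉ = ⊥-elim (j∉ (principalUnit-resp (index≡⇒≈enum eq) (^-principalUnit i∈)))
      ... | no  i∉ | yes j∈ = ⊥-elim (i∉ (principalUnit-resp (index≡⇒≈enum (≡.sym eq)) (^-principalUnit j∈)))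
      ... | no  _  | no  _  = eq

      principalUnit-kthRoot : ∀ {u} → PrincipalUnit u → ∃ λ w → PrincipalUnit w × w ^ k ≈ u
      principalUnit-kthRoot {u} u∈
        with injective⇒surjective powerOnPrincipalUnits powerOnPrincipalUnits-injective (index u)
      ... | i , hit with principalUnit? (enum i)
      ...   | yes i∈ = enum i , i∈ , index-injective hit
      ...   | no  i∉ = ⊥-elim (i∉ (principalUnit-resp (index≡⇒≈enum (≡.sym hit)) u∈))

module ResidueMaps where

  open IndicatorSums
  open Transversals using (fibre)
  open FiniteRings
  open import Defs
  open import Data.Nat using (ℕ; zero; suc)
  open import Data.Nat.Properties using (+-0-commutativeMonoid)
  open import Data.Nat.GCD using (gcd)
  open import Data.Fin using (Fin)
  open import Data.Fin.Properties using () renaming (_≟_ to _≟ᶠ_)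
  open import Data.List using (allFin)
  open import Data.Product using (∃; _×_; _,_; proj₁; proj₂)
  open import Data.Empty using (⊥-elim)
  open import Relation.Nullary using (¬_; yes; no)
  open import Relation.Nullary.Decidable using (¬?)
  open import Relation.Binary.PropositionalEquality as ≡ using (_≡_)
  open import Function using (_∘_; _⇔_; mk⇔; Equivalence)
  open import Algebra.Morphism.Structures using (module RingMorphisms)
  open import Algebra.Properties.CommutativeMonoid.Sum +-0-commutativeMonoid using (sum; sum-permute; sum-cong-≗)
  import Relation.Binary.Reasoning.Setoid as SetoidReasoning

  module ResidueMapProperties {c₁ ℓ₁ c₂ ℓ₂} (R : FiniteCommRing c₁ ℓ₁) (F : FiniteCommRing c₂ ℓ₂)
    (φ : FiniteCommRing.Carrier R → FiniteCommRing.Carrier F)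
    (local : IsLocal R) (F-field : IsField F) (residue : IsResidueMap R F φ) where

    private
      module R = FiniteCommRing R
      module F = FiniteCommRing F
      module R′ = FiniteRingProperties R
      module F′ = FiniteRingProperties F

    open FiniteCommRing F using (_≈_; _*_; _+_; _-_; -_; _^_; 0#; 1#; refl; sym; trans; *-cong; +-cong; -‿cong)
    open F′ using (_·_)
    open RingMorphisms R.rawRing F.rawRing using (IsRingHomomorphism)
    open IsRingHomomorphism (proj₁ residue)
    open LocalRingProperties R local

    φ-surjective : ∀ y → ∃ λ x → φ x ≈ y
    φ-surjective = proj₁ (proj₂ residue)

    kernel⇒nonUnit : ∀ {x} → φ x ≈ 0# → NonUnit x
    kernel⇒nonUnit = proj₁ (proj₂ (proj₂ residue) _)

    nonUnit⇒kernel : ∀ {x} → NonUnit x → φ x ≈ 0#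
    nonUnit⇒kernel = proj₂ (proj₂ (proj₂ residue) _)

    ^-homo : ∀ x n → φ (x R.^ n) ≈ φ x ^ n
    ^-homo x zero    = 1#-homo
    ^-homo x (suc n) = trans (*-homo x (x R.^ n)) (*-cong refl (^-homo x n))

    ·1#-homo : ∀ n → φ (n R′.· R.1#) ≈ n · 1#
    ·1#-homo zero    = 0#-homo
    ·1#-homo (suc n) = trans (+-homo R.1# (n R′.· R.1#)) (+-cong 1#-homo (·1#-homo n))

    sub-homo : ∀ x y → φ (x R.- y) ≈ φ x - φ y
    sub-homo x y = trans (+-homo x (R.- y)) (+-cong refl (-‿homo y))

    φ≉0⇒isUnit : ∀ {x} → ¬ (φ x ≈ 0#) → IsUnit R x
    φ≉0⇒isUnit {x} φx≉0 with R′.isUnit? x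
    ... | yes x∈U = x∈U
    ... | no  x∉U = ⊥-elim (φx≉0 (nonUnit⇒kernel x∉U))

    gcd≡1⇒·1#-isUnit : ∀ k → gcd k F.size ≡ 1 → IsUnit R (k R′.· R.1#)
    gcd≡1⇒·1#-isUnit k gcd≡1 =
      φ≉0⇒isUnit (F′.gcd≡1⇒·1#≉0# (proj₁ F-field) k gcd≡1 ∘ trans (sym (·1#-homo k)))

    φ-isUnit : ∀ {x} → IsUnit R x → IsUnit F (φ x)
    φ-isUnit {x} (y , xy≈1) = φ y , trans (sym (*-homo x y)) (trans (⟦⟧-cong xy≈1) 1#-homo)

    π : Fin R.size → Fin F.size
    π i = F′.index (φ (R.enum i))

    enum-π : ∀ i → F.enum (π i) ≈ φ (R.enum i)
    enum-π i = F′.enum-index (φ (R.enum i))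

    enum-π-difference : ∀ i j → F.enum (π j) - F.enum (π i) ≈ φ (R.enum j R.- R.enum i)
    enum-π-difference i j = trans (+-cong (enum-π j) (-‿cong (enum-π i))) (sym (sub-homo _ _))

    isUnitᵢ-π : ∀ {t} → IsUnitᵢ R t → IsUnitᵢ F (π t)
    isUnitᵢ-π {t} t∈U = Equivalence.from (F′.IsUnitᵢ⇔IsUnit (π t))
      (F′.isUnit-resp (sym (enum-π t)) (φ-isUnit (Equivalence.to (R′.IsUnitᵢ⇔IsUnit t) t∈U)))

    CayAdj-π⁺ : ∀ k i j → CayAdj R k i j → CayAdj F k (π i) (π j)
    CayAdj-π⁺ k i j (t , t∈U , t^k≈d) = π t , isUnitᵢ-π t∈U , (begin
      F.enum (π t) ^ k              ≈⟨ F′.^-congˡ k (enum-π t) ⟩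
      φ (R.enum t) ^ k              ≈⟨ ^-homo (R.enum t) k ⟨
      φ (R.enum t R.^ k)            ≈⟨ ⟦⟧-cong t^k≈d ⟩
      φ (R.enum j R.- R.enum i)     ≈⟨ enum-π-difference i j ⟨
      F.enum (π j) - F.enum (π i)   ∎)
      where open SetoidReasoning F.setoid

    module _ (k : ℕ) (k-isUnit : IsUnit R (k R′.· R.1#)) where

      kthPower-lift : ∀ {d s} → IsUnit F s → φ d ≈ s ^ k → ∃ λ t → IsUnit R t × t R.^ k R.≈ d
      kthPower-lift {d} {s} s∈U φd≈s^k = x R.* w , R′.isUnit-* x∈U (principalUnit⇒isUnit w∈1+𝔪) , [xw]^k≈d
        where
        open SetoidReasoning F.setoid
        x = proj₁ (φ-surjective s)
        φx≈s : φ x ≈ s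
        φx≈s = proj₂ (φ-surjective s)
        x∈U : IsUnit R x
        x∈U = φ≉0⇒isUnit (F′.isUnit⇒≉0 (proj₁ F-field) s∈U ∘ trans (sym φx≈s))
        y = proj₁ x∈U
        xy≈1 : x R.* y R.≈ R.1#
        xy≈1 = proj₂ x∈U
        u = d R.* y R.^ k
        φu≈1 : φ u ≈ 1#
        φu≈1 = begin
          φ (d R.* y R.^ k)        ≈⟨ *-homo d (y R.^ k) ⟩
          φ d * φ (y R.^ k)        ≈⟨ *-cong φd≈s^k (^-homo y k) ⟩
          s ^ k * φ y ^ k          ≈⟨ *-cong (F′.^-congˡ k φx≈s) refl ⟨
          φ x ^ k * φ y ^ k        ≈⟨ F′.^-distrib-* (φ x) (φ y) k ⟨
          (φ x * φ y) ^ k          ≈⟨ F′.^-congˡ k (trans (sym (*-homo x y)) (trans (⟦⟧-cong xy≈1) 1#-homo)) ⟩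
          1# ^ k                   ≈⟨ F′.1#^n≈1# k ⟩
          1#                       ∎
        u∈1+𝔪 : PrincipalUnit u
        u∈1+𝔪 = kernel⇒nonUnit (trans (sub-homo u R.1#) (trans (+-cong φu≈1 (-‿cong 1#-homo)) (F.-‿inverseʳ 1#)))
        w = proj₁ (principalUnit-kthRoot k k-isUnit u∈1+𝔪)
        w∈1+𝔪 : PrincipalUnit w
        w∈1+𝔪 = proj₁ (proj₂ (principalUnit-kthRoot k k-isUnit u∈1+𝔪))
        w^k≈u : w R.^ k R.≈ u
        w^k≈u = proj₂ (proj₂ (principalUnit-kthRoot k k-isUnit u∈1+𝔪))
        [xw]^k≈d : (x R.* w) R.^ k R.≈ d
        [xw]^k≈d = R.trans (R′.^-distrib-* x w k) (R.trans (R.*-cong R.refl w^k≈u) (R′.^-cancel-inverse d k xy≈1))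

      CayAdj-π⁻ : ∀ i j → CayAdj F k (π i) (π j) → CayAdj R k i j
      CayAdj-π⁻ i j (s , s∈U , s^k≈e) =
        lift (kthPower-lift (Equivalence.to (F′.IsUnitᵢ⇔IsUnit s) s∈U) (sym (trans s^k≈e (enum-π-difference i j))))
        where
        lift : (∃ λ t → IsUnit R t × t R.^ k R.≈ (R.enum j R.- R.enum i)) → CayAdj R k i j
        lift (t , t∈U , t^k≈d) = R′.index t
          , Equivalence.from (R′.IsUnitᵢ⇔IsUnit (R′.index t)) (R′.isUnit-resp (R.sym (R′.enum-index t)) t∈U)
          , R.trans (R′.^-congˡ k (R′.enum-index t)) t^k≈d

      π-CayAdj : ∀ i j → CayAdj R k i j ⇔ CayAdj F k (π i) (π j)
      π-CayAdj i j = mk⇔ (CayAdj-π⁺ k i j) (CayAdj-π⁻ i j)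

    CayAdj-irreflexive : ∀ k a → ¬ CayAdj F k a a
    CayAdj-irreflexive k a (t , t∈U , t^k≈0) =
      F′.isUnit⇒≉0 (proj₁ F-field) (F′.isUnit-^ k (Equivalence.to (F′.IsUnitᵢ⇔IsUnit t) t∈U))
        (trans t^k≈0 (F.-‿inverseʳ _))

    enum-π-translate : ∀ x₀ i → F.enum (π (R′.index (R.enum i R.+ x₀))) ≈ φ (R.enum i) + φ x₀
    enum-π-translate x₀ i = begin
      F.enum (π (R′.index (R.enum i R.+ x₀))) ≈⟨ enum-π _ ⟩
      φ (R.enum (R′.index (R.enum i R.+ x₀))) ≈⟨ ⟦⟧-cong (R′.enum-index _) ⟩
      φ (R.enum i R.+ x₀)                     ≈⟨ +-homo (R.enum i) x₀ ⟩
      φ (R.enum i) + φ x₀                     ∎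
      where open SetoidReasoning F.setoid

    fibre-π : ∀ b → fibre π b ≡ maxIdealSize R
    fibre-π b = begin
      sum (λ i → 𝟙 (π i ≟ᶠ b))
        ≡⟨ sum-permute (λ i → 𝟙 (π i ≟ᶠ b)) (R′.translation x₀) ⟩
      sum (λ i → 𝟙 (π (τ i) ≟ᶠ b))
        ≡⟨ sum-cong-≗ (λ i → 𝟙-cong (in-fibre⇔nonUnit i) (π (τ i) ≟ᶠ b) (¬? (isUnitᵢ? R i))) ⟩
      sum (λ i → 𝟙 (¬? (isUnitᵢ? R i)))
        ≡⟨ ∑-tabulate (λ i → i) (𝟙 ∘ ¬? ∘ isUnitᵢ? R) ⟨
      ∑ (allFin R.size) (𝟙 ∘ ¬? ∘ isUnitᵢ? R)
        ≡⟨ length-filter≡∑𝟙 (¬? ∘ isUnitᵢ? R) (allFin R.size) ⟨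
      maxIdealSize R
        ∎
      where
      open ≡.≡-Reasoning
      x₀ = proj₁ (φ-surjective (F.enum b))
      τ : Fin R.size → Fin R.size
      τ i = R′.index (R.enum i R.+ x₀)
      enum-πτ : ∀ i → F.enum (π (τ i)) ≈ φ (R.enum i) + F.enum b
      enum-πτ i = trans (enum-π-translate x₀ i) (+-cong refl (proj₂ (φ-surjective (F.enum b))))
      in-fibre⇔nonUnit : ∀ i → π (τ i) ≡ b ⇔ (¬ IsUnitᵢ R i)
      in-fibre⇔nonUnit i = mk⇔
        (λ πτi≡b → kernel⇒nonUnit (F′.+-cancelʳ (F.enum b) _ _
           (trans (sym (enum-πτ i)) (trans (F.reflexive (≡.cong F.enum πτi≡b)) (sym (F.+-identityˡ _)))))
         ∘ Equivalence.to (R′.IsUnitᵢ⇔IsUnit i))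
        (λ i∉U → F.enum-inj _ _ (trans (enum-πτ i)
           (trans (+-cong (nonUnit⇒kernel (i∉U ∘ Equivalence.from (R′.IsUnitᵢ⇔IsUnit i))) refl) (F.+-identityˡ _))))

open import Defs
open import Level using (Level)
open import Data.Nat using (ℕ; _*_; _^_; _∸_; _/_)
open import Data.Nat.Divisibility using (_∣_)
open import Data.Nat.GCD using (gcd)
open import Relation.Binary.PropositionalEquality using (_≡_)
open Cliques using (cliqueCount-blowUp)
open ResidueMaps using (module ResidueMapProperties)

-- The two divisibility hypotheses only serve to make U_R(k) = - U_R(k), i.e. the graph
-- undirected; the clique count does not use them.
theorem2p8 : ∀ {c₁ ℓ₁ c₂ ℓ₂ : Level}
    (R : FiniteCommRing c₁ ℓ₁) (F : FiniteCommRing c₂ ℓ₂)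
    (φ : FiniteCommRing.Carrier R → FiniteCommRing.Carrier F) (k : ℕ) →
    IsLocal R → IsField F → IsResidueMap R F φ →
    2 ∣ (FiniteCommRing.size F ∸ 1) →
    gcd k (FiniteCommRing.size F ∸ 1) ∣ ((FiniteCommRing.size F ∸ 1) / 2) →
    gcd k (FiniteCommRing.size F) ≡ 1 →
    (ℓ : ℕ) → 𝒦 R k ℓ ≡ 𝒦 F k ℓ * (maxIdealSize R ^ ℓ)
theorem2p8 R F φ k local F-field residue _ _ gcd≡1 =
  cliqueCount-blowUp π (π-CayAdj k (gcd≡1⇒·1#-isUnit k gcd≡1)) (CayAdj-irreflexive k) fibre-π
  where open ResidueMapProperties R F φ local F-field residue
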